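{- Let $n$ be a positive integer, and let $I_n'$ and $O_n'$ denote the integer programs $I_n$ and $O_n$, respectively, with the additional constraint $\sum_{S\in 2^{[n]}\setminus\{\emptyset\}} 2y_S\le\sum_{S\in 2^{[n]}} x_S$. Then: all downsets $\mathcal{D}$ with $|U(\mathcal{D})|\le n$ have the star property if and only if $I_n'$ is infeasible; and all downsets $\mathcal{D}$ with $|U(\mathcal{D})|\le n$ have the star property if and only if the optimal objective value of $O_n'$ is zero.
   Context: Let $[n]=\{1,\dots,n\}$ and $2^{[n]}$ its power set. $U(\mathcal{F})$ is the union of all sets in a family $\mathcal{F}$. A family $\mathcal{D}$ is a downset if $A\in\mathcal{D}$, $B\subseteq A$ imply $B\in\mathcal{D}$. A family is intersecting if any two of its sets have nonempty intersection; it is a star if some element of $U(\mathcal{F})$ lies in all its sets; $\mathcal{F}$ has the star property if some maximum-cardinality intersecting family contained in $\mathcal{F}$ is a star. The integer program $I_n$ has binary variables $x_S,y_S$ ($S\in 2^{[n]}$), objective $\max\sum_S x_S$, and constraints: $x_T\le x_S$ for all $S\subsetneq T$; $y_T+y_S\le 1$ for all nonempty disjoint $S,T\in 2^{[n]}$; $y_S\le x_S$ for all $S$; $\sum_{S: i\in S} x_S+1\le\sum_{S\ne\emptyset} y_S$ for all $i\in[n]$. The integer program $O_n$ has binary variables $x_S,y_S$ ($S\in 2^{[n]}$) and $z\in\mathbb{Z}_{\ge0}$, objective $\max\sum_{S\ne\emptyset} y_S - z$, and constraints: $y_T+y_S\le1$ for all nonempty disjoint $S,T\in 2^{[n]}$;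 $\sum_{S: i\in S} x_S\le z$ for all $i\in[n]$; $y_T\le x_S$ for all $S\subseteq T$. -}

module Defs where

open import Data.Bool using (Bool; true; false; if_then_else_)
open import Data.Nat using (ℕ; zero; suc; _+_; _*_; _≤_)
open import Data.Integer as ℤ using (ℤ; +_)
open import Data.List using (List; []; _∷_; [_]; map; _++_; foldr)
open import Data.Nat.ListAction using (sum)
open import Data.Fin using (Fin)
open import Data.Fin.Subset
  using (Subset; inside; outside; _∈_; _⊆_; _⊂_; _∩_; _∪_; ⊥; ∣_∣; Nonempty; Empty)
open import Data.Fin.Subset.Properties using (_∈?_; nonempty?)
open import Data.Vec using (_∷_; [])
open import Data.Product using (Σ; ∃; ∃-syntax; _×_)
open import Data.Sum using (_⊎_)
open import Relation.Nullary using (¬_; does)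
open import Relation.Binary.PropositionalEquality using (_≡_)

allSubsets : ∀ m → List (Subset m)
allSubsets zero    = [ [] ]
allSubsets (suc m) = map (inside ∷_) (allSubsets m) ++ map (outside ∷_) (allSubsets m)

ΣS : ∀ {m} → (Subset m → ℕ) → ℕ
ΣS {m} f = sum (map f (allSubsets m))

ΣS≠∅ : ∀ {m} → (Subset m → ℕ) → ℕ
ΣS≠∅ f = ΣS (λ S → if does (nonempty? S) then f S else 0)

ΣS∋ : ∀ {m} → Fin m → (Subset m → ℕ) → ℕ
ΣS∋ i f = ΣS (λ S → if does (i ∈? S) then f S else 0)

Family : ℕ → Set
Family m = Subset m → Bool

_∈F_ : ∀ {m} → Subset m → Family m → Set
A ∈F F = F A ≡ true

_⊆F_ : ∀ {m} → Family m → Family m → Set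
G ⊆F F = ∀ A → A ∈F G → A ∈F F

∣_∣F : ∀ {m} → Family m → ℕ
∣ F ∣F = ΣS (λ A → if F A then 1 else 0)

U : ∀ {m} → Family m → Subset m
U {m} F = foldr (λ A acc → if F A then A ∪ acc else acc) ⊥ (allSubsets m)

IsDownset : ∀ {m} → Family m → Set
IsDownset D = ∀ A B → B ⊆ A → A ∈F D → B ∈F D

Intersecting : ∀ {m} → Family m → Set
Intersecting G = ∀ A B → A ∈F G → B ∈F G → Nonempty (A ∩ B)

-- Star: some element of U(G) lies in all sets of G.
-- Convention: the empty family also counts as a star.
IsStar : ∀ {m} → Family m → Set
IsStar G = (∀ A → G A ≡ false) ⊎ (∃[ i ] (i ∈ U G × (∀ A → A ∈F G → i ∈ A)))

MaxIntersectingIn : ∀ {m} → Family m → Family m → Set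
MaxIntersectingIn F G =
  G ⊆F F × Intersecting G ×
  (∀ G′ → G′ ⊆F F → Intersecting G′ → ∣ G′ ∣F ≤ ∣ G ∣F)

StarProperty : ∀ {m} → Family m → Set
StarProperty F = ∃[ G ] (MaxIntersectingIn F G × IsStar G)

AllDownsetsStar : ℕ → Set
AllDownsetsStar n = ∀ m (D : Family m) → IsDownset D → ∣ U D ∣ ≤ n → StarProperty D

-- Integer programs.  Variables x_S, y_S indexed by S ∈ 2^[n], binary
-- (values in ℕ constrained to be ≤ 1); z ∈ ℤ≥0 is a natural number.

Binary : ∀ {n} → (Subset n → ℕ) → Set
Binary x = ∀ S → x S ≤ 1

I′-Feasible : ∀ n → (x y : Subset n → ℕ) → Set
I′-Feasible n x y =
  Binary x × Binary y ×
  (∀ S T → S ⊂ T → x T ≤ x S) ×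
  (∀ S T → Nonempty S → Nonempty T → Empty (S ∩ T) → y T + y S ≤ 1) ×
  (∀ S → y S ≤ x S) ×
  (∀ (i : Fin n) → ΣS∋ i x + 1 ≤ ΣS≠∅ y) ×
  (ΣS≠∅ (λ S → 2 * y S) ≤ ΣS x)

I′-Infeasible : ℕ → Set
I′-Infeasible n = ¬ (∃[ x ] ∃[ y ] I′-Feasible n x y)

O′-Feasible : ∀ n → (x y : Subset n → ℕ) → ℕ → Set
O′-Feasible n x y z =
  Binary x × Binary y ×
  (∀ S T → Nonempty S → Nonempty T → Empty (S ∩ T) → y T + y S ≤ 1) ×
  (∀ (i : Fin n) → ΣS∋ i x ≤ z) ×
  (∀ S T → S ⊆ T → y T ≤ x S) ×
  (ΣS≠∅ (λ S → 2 * y S) ≤ ΣS x)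

O-objective : ∀ {n} → (y : Subset n → ℕ) → ℕ → ℤ
O-objective y z = + (ΣS≠∅ y) ℤ.- + z

O′-OptimalValue : ℕ → ℤ → Set
O′-OptimalValue n v =
  (∃[ x ] ∃[ y ] ∃[ z ] (O′-Feasible n x y z × O-objective y z ≡ v)) ×
  (∀ x y z → O′-Feasible n x y z → O-objective y z ℤ.≤ v)

module Submission where

-- A downset D fails the star property exactly when it has an intersecting subfamily G
-- larger than every degree of D, the degree of i being the size of the star of i in D.
-- Deleting points outside U(D) and adding unused ones moves such an obstruction onto the
-- ground set [n]. Kleitman's bound 2|G| ≤ |D|, a consequence of Harris' correlation
-- inequality, shows that the indicator vectors of D and G satisfy the extra constraint, so
-- they form a feasible point of I′ₙ and a point of O′ₙ of value 1. Conversely, from a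
-- feasible point of I′ₙ, or of O′ₙ with positive value, the family {S ≠ ∅ : y_S = 1} is
-- intersecting and, as x dominates the indicator of the downset it generates, beats every
-- star of that downset.

open import Defs
open import Data.Bool using (Bool; true; false; if_then_else_; _∧_)
open import Data.Bool.Properties using (_≟_; ¬-not; ∧-conicalˡ; ∧-conicalʳ; ∧-identityʳ; ∧-zeroʳ)
open import Data.Nat using (ℕ; zero; suc; _+_; _*_; _≤_; _<_; _∸_; _^_; z≤n; s≤s; _≤?_)
open import Data.Nat.Properties hiding (_≟_)
open import Algebra.Properties.CommutativeSemigroup +-commutativeSemigroup using (interchange)
import Algebra.Properties.CommutativeSemigroup *-commutativeSemigroup as *-Semigroup
open import Data.Nat.Solver using (module +-*-Solver)
open import Data.Integer as ℤ using (+_)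
open import Data.Integer.Properties using (drop‿+≤+; i-j≤0⇒i≤j; i≤j⇒i-j≤0)
open import Data.List using ([]; _∷_; map; _++_; foldr; allFin)
open import Data.List.Properties using (map-++; map-∘)
open import Data.List.Extrema.Nat using (argmax; f[xs]≤f[argmax])
open import Data.List.Relation.Unary.All as All using ()
open import Data.Nat.ListAction using (sum)
open import Data.Nat.ListAction.Properties using (sum-++)
open import Data.List.Membership.Propositional using () renaming (_∈_ to _∈L_)
open import Data.List.Membership.Propositional.Properties using (∈-map⁺; ∈-++⁺ˡ; ∈-++⁺ʳ; ∈-allFin)
open import Data.List.Relation.Unary.Any as Any using ()
open import Data.Fin using (Fin; zero; suc; punchIn)
open import Data.Fin.Properties using (¬∀⟶∃¬)
open import Data.Fin.Subset
  using (Subset; inside; outside; _∈_; _∉_; _⊆_; _⊂_; _∩_; _∪_; ⊥; ⊤; ∣_∣; Nonempty; Empty; ∁)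
open import Data.Fin.Subset.Properties
  using ( _∈?_; nonempty?; _⊆?_; anySubset?; ∣p∣≤n; ∣⊤∣≡n; p⊆q⇒∣p∣≤∣q∣; p⊆p∪q; q⊆p∪q
        ; ⊆-refl; s⊆s; out⊆; drop-∷-⊆; x∈p∩q⁺; x∈p∩q⁻; x∈p⇒x∉∁p )
open import Data.Vec using (_∷_; []; insertAt; removeAt; lookup; here; there)
open import Data.Vec.Properties using (insertAt-lookup; insertAt-removeAt; lookup⇒[]=)
open import Data.Product using (∃-syntax; _×_; _,_; proj₁; map₂; uncurry)
open import Data.Sum as Sum using (_⊎_; inj₁; inj₂)
open import Function using (_∘_)
open import Function.Bundles using (_⇔_; mk⇔)
open import Relation.Nullary using (¬_; Dec; yes; no; does; _×-dec_; contradiction)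
open import Relation.Nullary.Decidable using (dec-true)
open import Relation.Binary.PropositionalEquality

private
  variable
    m n : ℕ

toℕ : Bool → ℕ
toℕ b = if b then 1 else 0

toℕ≤1 : ∀ b → toℕ b ≤ 1
toℕ≤1 true  = s≤s z≤n
toℕ≤1 false = z≤n

toℕ-mono : ∀ {b c} → (b ≡ true → c ≡ true) → toℕ b ≤ toℕ c
toℕ-mono {true}  b⇒c rewrite b⇒c refl = ≤-refl
toℕ-mono {false} _   = z≤n

toℕ+toℕ≤1 : ∀ b c → ¬ (b ≡ true × c ≡ true) → toℕ b + toℕ c ≤ 1
toℕ+toℕ≤1 true  true  not-both = contradiction (refl , refl) not-both
toℕ+toℕ≤1 true  false _        = ≤-refl
toℕ+toℕ≤1 false c     _        = toℕ≤1 c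

toℕ-∧ : ∀ b c → toℕ (b ∧ c) ≡ (if c then toℕ b else 0)
toℕ-∧ b true  = cong toℕ (∧-identityʳ b)
toℕ-∧ b false = cong toℕ (∧-zeroʳ b)

toℕ-does-1≤? : ∀ k → k ≤ 1 → toℕ (does (1 ≤? k)) ≡ k
toℕ-does-1≤? zero          _ = refl
toℕ-does-1≤? (suc zero)    _ = refl
toℕ-does-1≤? (suc (suc k)) (s≤s ())

module _ {A : Set} where

  sum-map-mono : ∀ {f g : A → ℕ} → (∀ x → f x ≤ g x) → ∀ xs → sum (map f xs) ≤ sum (map g xs)
  sum-map-mono f≤g []       = z≤n
  sum-map-mono f≤g (x ∷ xs) = +-mono-≤ (f≤g x) (sum-map-mono f≤g xs)

  sum-map-cong : ∀ {f g : A → ℕ} → (∀ x → f x ≡ g x) → ∀ xs → sum (map f xs) ≡ sum (map g xs)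
  sum-map-cong f≗g []       = refl
  sum-map-cong f≗g (x ∷ xs) = cong₂ _+_ (f≗g x) (sum-map-cong f≗g xs)

  sum-map-zero : ∀ xs → sum (map (λ (_ : A) → 0) xs) ≡ 0
  sum-map-zero []       = refl
  sum-map-zero (_ ∷ xs) = sum-map-zero xs

  sum-map-+ : ∀ (f g : A → ℕ) xs →
              sum (map (λ x → f x + g x) xs) ≡ sum (map f xs) + sum (map g xs)
  sum-map-+ f g []       = refl
  sum-map-+ f g (x ∷ xs) =
    trans (cong (λ s → f x + g x + s) (sum-map-+ f g xs)) (interchange (f x) (g x) _ _)

  sum-map-*ˡ : ∀ k (f : A → ℕ) xs → sum (map (λ x → k * f x) xs) ≡ k * sum (map f xs)
  sum-map-*ˡ k f []       = sym (*-zeroʳ k)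
  sum-map-*ˡ k f (x ∷ xs) =
    trans (cong (λ s → k * f x + s) (sum-map-*ˡ k f xs)) (sym (*-distribˡ-+ k (f x) _))

∈-allSubsets : (S : Subset m) → S ∈L allSubsets m
∈-allSubsets []                      = Any.here refl
∈-allSubsets {suc m} (inside ∷ S)  = ∈-++⁺ˡ (∈-map⁺ (inside ∷_) (∈-allSubsets S))
∈-allSubsets {suc m} (outside ∷ S) =
  ∈-++⁺ʳ (map (inside ∷_) (allSubsets m)) (∈-map⁺ (outside ∷_) (∈-allSubsets S))

ΣS-cong : {f g : Subset m → ℕ} → (∀ A → f A ≡ g A) → ΣS f ≡ ΣS g
ΣS-cong {m} f≗g = sum-map-cong f≗g (allSubsets m)

ΣS-mono : {f g : Subset m → ℕ} → (∀ A → f A ≤ g A) → ΣS f ≤ ΣS g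
ΣS-mono {m} f≤g = sum-map-mono f≤g (allSubsets m)

ΣS-zero : {f : Subset m → ℕ} → (∀ A → f A ≡ 0) → ΣS f ≡ 0
ΣS-zero {m} f≗0 = trans (ΣS-cong f≗0) (sum-map-zero (allSubsets m))

ΣS-+ : (f g : Subset m → ℕ) → ΣS (λ A → f A + g A) ≡ ΣS f + ΣS g
ΣS-+ {m} f g = sum-map-+ f g (allSubsets m)

ΣS-*ˡ : ∀ k (f : Subset m → ℕ) → ΣS (λ A → k * f A) ≡ k * ΣS f
ΣS-*ˡ {m} k f = sum-map-*ˡ k f (allSubsets m)

ΣS-∷ : (f : Subset (suc m) → ℕ) → ΣS f ≡ ΣS (f ∘ (inside ∷_)) + ΣS (f ∘ (outside ∷_))
ΣS-∷ {m} f = begin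
  sum (map f (map (inside ∷_) L ++ map (outside ∷_) L))
    ≡⟨ cong sum (map-++ f (map (inside ∷_) L) _) ⟩
  sum (map f (map (inside ∷_) L) ++ map f (map (outside ∷_) L))
    ≡⟨ sum-++ (map f (map (inside ∷_) L)) _ ⟩
  sum (map f (map (inside ∷_) L)) + sum (map f (map (outside ∷_) L))
    ≡⟨ cong₂ _+_ (cong sum (sym (map-∘ L))) (cong sum (sym (map-∘ L))) ⟩
  ΣS (f ∘ (inside ∷_)) + ΣS (f ∘ (outside ∷_)) ∎
  where
  open ≡-Reasoning
  L = allSubsets m

ΣS-insertAt : ∀ (j : Fin (suc m)) (f : Subset (suc m) → ℕ) →
              ΣS f ≡ ΣS (λ A → f (insertAt A j inside)) + ΣS (λ A → f (insertAt A j outside))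
ΣS-insertAt zero          f = ΣS-∷ f
ΣS-insertAt {suc m} (suc j) f = begin
  ΣS f
    ≡⟨ ΣS-∷ f ⟩
  ΣS (f ∘ (inside ∷_)) + ΣS (f ∘ (outside ∷_))
    ≡⟨ cong₂ _+_ (ΣS-insertAt j (f ∘ (inside ∷_))) (ΣS-insertAt j (f ∘ (outside ∷_))) ⟩
  (part inside inside + part inside outside) + (part outside inside + part outside outside)
    ≡⟨ interchange (part inside inside) (part inside outside) (part outside inside) _ ⟩
  (part inside inside + part outside inside) + (part inside outside + part outside outside)
    ≡⟨ cong₂ _+_ (ΣS-∷ (λ A → f (insertAt A (suc j) inside)))
                 (ΣS-∷ (λ A → f (insertAt A (suc j) outside))) ⟨
  ΣS (λ A → f (insertAt A (suc j) inside)) + ΣS (λ A → f (insertAt A (suc j) outside)) ∎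
  where
  open ≡-Reasoning
  part : Bool → Bool → ℕ
  part s t = ΣS (λ A → f (s ∷ insertAt A j t))

ΣS-∁ : (f : Subset m → ℕ) → ΣS (f ∘ ∁) ≡ ΣS f
ΣS-∁ {zero}  f = refl
ΣS-∁ {suc m} f = begin
  ΣS (f ∘ ∁)
    ≡⟨ ΣS-∷ (f ∘ ∁) ⟩
  ΣS (f ∘ (outside ∷_) ∘ ∁) + ΣS (f ∘ (inside ∷_) ∘ ∁)
    ≡⟨ cong₂ _+_ (ΣS-∁ (f ∘ (outside ∷_))) (ΣS-∁ (f ∘ (inside ∷_))) ⟩
  ΣS (f ∘ (outside ∷_)) + ΣS (f ∘ (inside ∷_))
    ≡⟨ +-comm (ΣS (f ∘ (outside ∷_))) _ ⟩
  ΣS (f ∘ (inside ∷_)) + ΣS (f ∘ (outside ∷_))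
    ≡⟨ ΣS-∷ f ⟨
  ΣS f ∎
  where open ≡-Reasoning

ΣS-1 : ΣS {m} (λ _ → 1) ≡ 2 ^ m
ΣS-1 {zero}  = refl
ΣS-1 {suc m} = begin
  ΣS {suc m} (λ _ → 1)                ≡⟨ ΣS-∷ {m} (λ _ → 1) ⟩
  ΣS {m} (λ _ → 1) + ΣS {m} (λ _ → 1) ≡⟨ cong₂ _+_ (ΣS-1 {m}) (ΣS-1 {m}) ⟩
  2 ^ m + 2 ^ m                       ≡⟨ cong (λ s → 2 ^ m + s) (+-identityʳ (2 ^ m)) ⟨
  2 ^ suc m                           ∎
  where open ≡-Reasoning

deg : Fin m → Family m → ℕ
deg i D = ΣS∋ i (toℕ ∘ D)

IsUpset : Family m → Set
IsUpset F = ∀ A B → A ⊆ B → A ∈F F → B ∈F F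

_∩F_ : Family m → Family m → Family m
(F ∩F G) A = F A ∧ G A

familyOf : {P : Subset m → Set} → (∀ A → Dec (P A)) → Family m
familyOf P? A = does (P? A)

module _ {P : Subset m → Set} (P? : ∀ A → Dec (P A)) where

  ∈-familyOf⁺ : ∀ {A} → P A → A ∈F familyOf P?
  ∈-familyOf⁺ {A} = dec-true (P? A)

  ∈-familyOf⁻ : ∀ {A} → A ∈F familyOf P? → P A
  ∈-familyOf⁻ {A} with P? A
  ... | yes p = λ _ → p
  ... | no _  = λ ()

support : (Subset m → ℕ) → Family m
support x = familyOf (λ A → 1 ≤? x A)

nonemptySets : Family m
nonemptySets = familyOf nonempty?

containing : Fin m → Family m
containing i = familyOf (i ∈?_)

hasSubsetIn? : (G : Family m) (A : Subset m) → Dec (∃[ B ] (B ∈F G × B ⊆ A))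
hasSubsetIn? G A = anySubset? (λ B → (G B ≟ true) ×-dec (B ⊆? A))

hasSupersetIn? : (G : Family m) (A : Subset m) → Dec (∃[ B ] (B ∈F G × A ⊆ B))
hasSupersetIn? G A = anySubset? (λ B → (G B ≟ true) ×-dec (A ⊆? B))

upClosure : Family m → Family m
upClosure G = familyOf (hasSubsetIn? G)

downClosure : Family m → Family m
downClosure G = familyOf (hasSupersetIn? G)

⊆F-false : ∀ {G D : Family m} → G ⊆F D → ∀ A → D A ≡ false → G A ≡ false
⊆F-false G⊆D A A∉D = ¬-not (λ A∈G → contradiction (trans (sym (G⊆D A A∈G)) A∉D) λ ())

∩F-⊆F-left : (F G : Family m) → (F ∩F G) ⊆F F
∩F-⊆F-left F G A = ∧-conicalˡ (F A) (G A)

LivesOn : Family m → Subset m → Set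
LivesOn D W = ∀ A → A ∈F D → A ⊆ W

livesOn-U : (F : Family m) → LivesOn F (U F)
livesOn-U {m} F A A∈F = go (allSubsets m) (∈-allSubsets A)
  where
  go : ∀ xs → A ∈L xs → A ⊆ foldr (λ B acc → if F B then B ∪ acc else acc) ⊥ xs
  go (_ ∷ _) (Any.here refl) rewrite A∈F = p⊆p∪q _
  go (B ∷ xs) (Any.there A∈xs) with F B
  ... | true  = q⊆p∪q B _ ∘ go xs A∈xs
  ... | false = go xs A∈xs

∣support∩nonempty∣ : {y : Subset m → ℕ} → Binary y → ∣ support y ∩F nonemptySets ∣F ≡ ΣS≠∅ y
∣support∩nonempty∣ {y = y} binary = ΣS-cong λ A → begin
  toℕ (support y A ∧ does (nonempty? A))                 ≡⟨ toℕ-∧ (support y A) _ ⟩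
  (if does (nonempty? A) then toℕ (support y A) else 0) ≡⟨ cong (if does (nonempty? A) then_else 0)
                                                             (toℕ-does-1≤? (y A) (binary A)) ⟩
  (if does (nonempty? A) then y A else 0)               ∎
  where open ≡-Reasoning

∣∩containing∣ : ∀ (D : Family m) i → ∣ D ∩F containing i ∣F ≡ deg i D
∣∩containing∣ D i = ΣS-cong (λ A → toℕ-∧ (D A) (does (i ∈? A)))

-- Harris' correlation inequality and Kleitman's bound

-- The surplus of the right-hand side is (u₁ - u₀) (d₀ - d₁).
chebyshev : ∀ {u₀ u₁ d₀ d₁} → u₀ ≤ u₁ → d₁ ≤ d₀ →
            2 * (u₁ * d₁ + u₀ * d₀) ≤ (u₁ + u₀) * (d₁ + d₀)
chebyshev {u₀} {d₁ = d₁} u₀≤u₁ d₁≤d₀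
  with a , refl ← m≤n⇒∃[o]m+o≡n u₀≤u₁ | b , refl ← m≤n⇒∃[o]m+o≡n d₁≤d₀ =
  ≤-trans (m≤m+n _ (a * b)) (≤-reflexive (identity u₀ a d₁ b))
  where
  open +-*-Solver
  identity : ∀ u a d b → 2 * ((u + a) * d + u * (d + b)) + a * b ≡ (u + a + u) * (d + (d + b))
  identity = solve 4 (λ u a d b → con 2 :* ((u :+ a) :* d :+ u :* (d :+ b)) :+ a :* b
                                  := (u :+ a :+ u) :* (d :+ (d :+ b))) refl

-- Split on the first point: the slices satisfy F₀ ⊆ F₁ and D₁ ⊆ D₀, so the two
-- inductive bounds combine by Chebyshev's sum inequality.
harris : ∀ {F D : Family m} → IsUpset F → IsDownset D → 2 ^ m * ∣ F ∩F D ∣F ≤ ∣ F ∣F * ∣ D ∣F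
harris {zero} {F} {D} _ _ with F [] | D []
... | true  | true  = ≤-refl
... | true  | false = z≤n
... | false | _     = z≤n
harris {suc m} {F} {D} upF downD = begin
  2 ^ suc m * ∣ F ∩F D ∣F
    ≡⟨ cong (2 ^ suc m *_) (ΣS-∷ (toℕ ∘ (F ∩F D))) ⟩
  2 * 2 ^ m * (∣ F₁ ∩F D₁ ∣F + ∣ F₀ ∩F D₀ ∣F)
    ≡⟨ trans (*-assoc 2 (2 ^ m) _) (cong (2 *_) (*-distribˡ-+ (2 ^ m) _ _)) ⟩
  2 * (2 ^ m * ∣ F₁ ∩F D₁ ∣F + 2 ^ m * ∣ F₀ ∩F D₀ ∣F)
    ≤⟨ *-monoʳ-≤ 2 (+-mono-≤ (harris (slice-upset inside) (slice-downset inside))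
                             (harris (slice-upset outside) (slice-downset outside))) ⟩
  2 * (∣ F₁ ∣F * ∣ D₁ ∣F + ∣ F₀ ∣F * ∣ D₀ ∣F)
    ≤⟨ chebyshev (slices-ordered (λ A → upF (outside ∷ A) (inside ∷ A) (out⊆ ⊆-refl)))
                 (slices-ordered (λ A → downD (inside ∷ A) (outside ∷ A) (out⊆ ⊆-refl))) ⟩
  (∣ F₁ ∣F + ∣ F₀ ∣F) * (∣ D₁ ∣F + ∣ D₀ ∣F)
    ≡⟨ cong₂ _*_ (ΣS-∷ (toℕ ∘ F)) (ΣS-∷ (toℕ ∘ D)) ⟨
  ∣ F ∣F * ∣ D ∣F ∎
  where
  open ≤-Reasoning
  F₁ F₀ D₁ D₀ : Family m
  F₁ = F ∘ (inside ∷_)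
  F₀ = F ∘ (outside ∷_)
  D₁ = D ∘ (inside ∷_)
  D₀ = D ∘ (outside ∷_)
  slice-upset : ∀ s → IsUpset (F ∘ (s ∷_))
  slice-upset s A B A⊆B = upF (s ∷ A) (s ∷ B) (s⊆s A⊆B)
  slice-downset : ∀ s → IsDownset (D ∘ (s ∷_))
  slice-downset s A B B⊆A = downD (s ∷ A) (s ∷ B) (s⊆s B⊆A)
  slices-ordered : ∀ {H K : Family m} → (∀ A → A ∈F H → A ∈F K) → ∣ H ∣F ≤ ∣ K ∣F
  slices-ordered H⊆K = ΣS-mono (λ A → toℕ-mono (H⊆K A))

-- Pair each set with its complement: an intersecting family contains at most one of the two.
intersecting-≤-half : (F : Family m) → Intersecting F → 2 * ∣ F ∣F ≤ 2 ^ m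
intersecting-≤-half {m} F intersecting = begin
  2 * ∣ F ∣F                          ≡⟨ cong (_+_ ∣ F ∣F) (+-identityʳ ∣ F ∣F) ⟩
  ∣ F ∣F + ∣ F ∣F                     ≡⟨ cong (_+_ ∣ F ∣F) (ΣS-∁ (toℕ ∘ F)) ⟨
  ∣ F ∣F + ΣS (toℕ ∘ F ∘ ∁)           ≡⟨ ΣS-+ (toℕ ∘ F) (toℕ ∘ F ∘ ∁) ⟨
  ΣS (λ A → toℕ (F A) + toℕ (F (∁ A))) ≤⟨ ΣS-mono (λ A → toℕ+toℕ≤1 _ _ (not-both A)) ⟩
  ΣS {m} (λ _ → 1)                    ≡⟨ ΣS-1 {m} ⟩
  2 ^ m                               ∎
  where
  open ≤-Reasoning
  not-both : ∀ A → ¬ (A ∈F F × ∁ A ∈F F)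
  not-both A (A∈F , ∁A∈F) =
    let x , x∈A∩∁A = intersecting A (∁ A) A∈F ∁A∈F
        x∈A , x∈∁A = x∈p∩q⁻ A (∁ A) x∈A∩∁A
    in x∈p⇒x∉∁p x∈A x∈∁A

upClosure-upset : (G : Family m) → IsUpset (upClosure G)
upClosure-upset G A B A⊆B A∈ =
  let C , C∈G , C⊆A = ∈-familyOf⁻ (hasSubsetIn? G) A∈
  in ∈-familyOf⁺ (hasSubsetIn? G) (C , C∈G , A⊆B ∘ C⊆A)

upClosure-intersecting : (G : Family m) → Intersecting G → Intersecting (upClosure G)
upClosure-intersecting G intersecting A B A∈ B∈ =
  let C , C∈G , C⊆A = ∈-familyOf⁻ (hasSubsetIn? G) A∈
      E , E∈G , E⊆B = ∈-familyOf⁻ (hasSubsetIn? G) B∈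
      x , x∈C∩E     = intersecting C E C∈G E∈G
      x∈C , x∈E     = x∈p∩q⁻ C E x∈C∩E
  in x , x∈p∩q⁺ (C⊆A x∈C , E⊆B x∈E)

⊆F-upClosure : (G : Family m) → G ⊆F upClosure G
⊆F-upClosure G A A∈G = ∈-familyOf⁺ (hasSubsetIn? G) (A , A∈G , ⊆-refl)

-- Harris' inequality for D and the up-closure of G, which is still intersecting.
kleitman : ∀ {D G : Family m} → IsDownset D → G ⊆F D → Intersecting G → 2 * ∣ G ∣F ≤ ∣ D ∣F
kleitman {m} {D} {G} downD G⊆D intersecting = *-cancelˡ-≤ (2 ^ m) {{m^n≢0 2 m}} (begin
  2 ^ m * (2 * ∣ G ∣F)          ≡⟨ *-Semigroup.x∙yz≈y∙xz (2 ^ m) 2 ∣ G ∣F ⟩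
  2 * (2 ^ m * ∣ G ∣F)          ≤⟨ *-monoʳ-≤ 2 (*-monoʳ-≤ (2 ^ m) G≤Up∩D) ⟩
  2 * (2 ^ m * ∣ Up ∩F D ∣F)    ≤⟨ *-monoʳ-≤ 2 (harris (upClosure-upset G) downD) ⟩
  2 * (∣ Up ∣F * ∣ D ∣F)        ≡⟨ *-assoc 2 ∣ Up ∣F ∣ D ∣F ⟨
  2 * ∣ Up ∣F * ∣ D ∣F          ≤⟨ *-monoˡ-≤ ∣ D ∣F
                                     (intersecting-≤-half Up (upClosure-intersecting G intersecting)) ⟩
  2 ^ m * ∣ D ∣F                ∎)
  where
  open ≤-Reasoning
  Up = upClosure G
  G≤Up∩D : ∣ G ∣F ≤ ∣ Up ∩F D ∣F
  G≤Up∩D = ΣS-mono (λ A → toℕ-mono (λ A∈G → cong₂ _∧_ (⊆F-upClosure G A A∈G) (G⊆D A A∈G)))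

∣∣F-≤-deg : ∀ {S D : Family m} i → S ⊆F D → (∀ A → A ∈F S → i ∈ A) → ∣ S ∣F ≤ deg i D
∣∣F-≤-deg {S = S} {D} i S⊆D S∋i = ΣS-mono bound
  where
  bound : ∀ A → toℕ (S A) ≤ (if does (i ∈? A) then toℕ (D A) else 0)
  bound A with S A in A∈S
  ... | false = z≤n
  ... | true rewrite dec-true (i ∈? A) (S∋i A A∈S) | S⊆D A A∈S = ≤-refl

DegreeBounded : Family m → Set
DegreeBounded D = ∀ G → G ⊆F D → Intersecting G → ∣ G ∣F ≡ 0 ⊎ ∃[ i ] ∣ G ∣F ≤ deg i D

star-degreeBound : ∀ {S D : Family m} → S ⊆F D → IsStar S → ∣ S ∣F ≡ 0 ⊎ ∃[ i ] ∣ S ∣F ≤ deg i D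
star-degreeBound _   (inj₁ S≗∅)            = inj₁ (ΣS-zero (λ A → cong toℕ (S≗∅ A)))
star-degreeBound S⊆D (inj₂ (i , _ , S∋i)) = inj₂ (i , ∣∣F-≤-deg i S⊆D S∋i)

starProperty⇒degreeBounded : {D : Family m} → StarProperty D → DegreeBounded D
starProperty⇒degreeBounded (S , (S⊆D , _ , maximum) , star) G G⊆D intersecting
  with star-degreeBound S⊆D star
... | inj₁ ∣S∣≡0      = inj₁ (n≤0⇒n≡0 (subst (∣ G ∣F ≤_) ∣S∣≡0 (maximum G G⊆D intersecting)))
... | inj₂ (i , ∣S∣≤) = inj₂ (i , ≤-trans (maximum G G⊆D intersecting) ∣S∣≤)

∩containing-isStar : ∀ (D : Family m) i → IsStar (D ∩F containing i)
∩containing-isStar {m} D i with anySubset? (λ A → (D ∩F containing i) A ≟ true)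
... | no ∄member     = inj₁ (λ A → ¬-not (λ A∈S → ∄member (A , A∈S)))
... | yes (A , A∈S) = inj₂ (i , livesOn-U S A A∈S (∋i A A∈S) , ∋i)
  where
  S : Family m
  S = D ∩F containing i
  ∋i : ∀ B → B ∈F S → i ∈ B
  ∋i B B∈S = ∈-familyOf⁻ (i ∈?_) (∧-conicalʳ (D B) _ B∈S)

∩containing-intersecting : ∀ (D : Family m) i → Intersecting (D ∩F containing i)
∩containing-intersecting D i A B A∈ B∈ =
  i , x∈p∩q⁺ ( ∈-familyOf⁻ (i ∈?_) (∧-conicalʳ (D A) _ A∈)
             , ∈-familyOf⁻ (i ∈?_) (∧-conicalʳ (D B) _ B∈))

degreeBounded⇒≤ : {D : Family m} → DegreeBounded D → ∀ {c} → (∀ i → deg i D ≤ c) →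
                  ∀ G → G ⊆F D → Intersecting G → ∣ G ∣F ≤ c
degreeBounded⇒≤ bounded deg≤c G G⊆D intersecting with bounded G G⊆D intersecting
... | inj₁ ∣G∣≡0     = ≤-trans (≤-reflexive ∣G∣≡0) z≤n
... | inj₂ (i , ∣G∣≤) = ≤-trans ∣G∣≤ (deg≤c i)

-- The star at a vertex of maximum degree; on the empty ground set, the empty family.
degreeBounded⇒starProperty : {D : Family m} → DegreeBounded D → StarProperty D
degreeBounded⇒starProperty {zero} bounded =
  (λ _ → false) , ((λ _ ()) , (λ _ _ ()) , degreeBounded⇒≤ bounded (λ ())) , inj₁ (λ _ → refl)
degreeBounded⇒starProperty {suc k} {D} bounded =
  D ∩F containing i* ,
  ( ∩F-⊆F-left D (containing i*) , ∩containing-intersecting D i*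
  , degreeBounded⇒≤ bounded deg≤∣S∣ ) ,
  ∩containing-isStar D i*
  where
  i* : Fin (suc k)
  i* = argmax (λ i → deg i D) zero (allFin (suc k))
  deg≤∣S∣ : ∀ i → deg i D ≤ ∣ D ∩F containing i* ∣F
  deg≤∣S∣ i =
    ≤-trans (All.lookup (f[xs]≤f[argmax] {f = λ i → deg i D} zero (allFin (suc k))) (∈-allFin i))
            (≤-reflexive (sym (∣∩containing∣ D i*)))

-- Obstructions and the size of the ground set

record Obstruction {m} (D G : Family m) : Set where
  field
    downset      : IsDownset D
    G⊆D          : G ⊆F D
    intersecting : Intersecting G
    nonempty     : 1 ≤ ∣ G ∣F
    beatsStars   : ∀ i → deg i D < ∣ G ∣F

∃Obstruction : ℕ → Set
∃Obstruction n = ∃[ D ] ∃[ G ] Obstruction {n} D G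

pad : Family m → Family (suc m)
pad F (inside  ∷ A) = false
pad F (outside ∷ A) = F A

if-then-0-else-0 : ∀ b → (if b then 0 else 0) ≡ 0
if-then-0-else-0 true  = refl
if-then-0-else-0 false = refl

∣pad∣ : (F : Family m) → ∣ pad F ∣F ≡ ∣ F ∣F
∣pad∣ {m} F = trans (ΣS-∷ (toℕ ∘ pad F)) (cong (_+ ∣ F ∣F) (ΣS-zero {m} (λ _ → refl)))

deg-pad-zero : (D : Family m) → deg zero (pad D) ≡ 0
deg-pad-zero D = ΣS-zero vanishes
  where
  vanishes : ∀ A → (if does (zero ∈? A) then toℕ (pad D A) else 0) ≡ 0
  vanishes (inside  ∷ A) = refl
  vanishes (outside ∷ A) = refl

deg-pad-suc : (D : Family m) (i : Fin m) → deg (suc i) (pad D) ≡ deg i D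
deg-pad-suc {m} D i =
  trans (ΣS-∷ {m} _) (cong (_+ deg i D) (ΣS-zero {m} (λ A → if-then-0-else-0 (does (i ∈? A)))))

pad-obstruction : ∀ {D G : Family m} → Obstruction D G → Obstruction (pad D) (pad G)
pad-obstruction {D = D} {G} ob = record
  { downset      = downset′
  ; G⊆D          = G⊆D′
  ; intersecting = intersecting′
  ; nonempty     = subst (1 ≤_) (sym (∣pad∣ G)) nonempty
  ; beatsStars   = beatsStars′
  }
  where
  open Obstruction ob
  downset′ : IsDownset (pad D)
  downset′ (outside ∷ A) (outside ∷ B) B⊆A = downset A B (drop-∷-⊆ B⊆A)
  downset′ (outside ∷ A) (inside  ∷ B) B⊆A = contradiction (B⊆A here) λ ()
  G⊆D′ : pad G ⊆F pad D
  G⊆D′ (outside ∷ A) = G⊆D A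
  intersecting′ : Intersecting (pad G)
  intersecting′ (outside ∷ A) (outside ∷ B) A∈ B∈ =
    let x , x∈A∩B = intersecting A B A∈ B∈ in suc x , there x∈A∩B
  beatsStars′ : ∀ i → deg i (pad D) < ∣ pad G ∣F
  beatsStars′ zero    rewrite deg-pad-zero D  | ∣pad∣ G = nonempty
  beatsStars′ (suc i) rewrite deg-pad-suc D i | ∣pad∣ G = beatsStars i

pad-∃Obstruction : ∀ k → ∃Obstruction m → ∃Obstruction (k + m)
pad-∃Obstruction zero    ob             = ob
pad-∃Obstruction (suc k) ob with D , G , ob′ ← pad-∃Obstruction k ob =
  pad D , pad G , pad-obstruction ob′

insertAt-⊆ : ∀ (j : Fin (suc m)) b {A B : Subset m} → B ⊆ A → insertAt B j b ⊆ insertAt A j b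
insertAt-⊆ zero    b B⊆A = s⊆s B⊆A
insertAt-⊆ (suc j) b {_ ∷ A}       {outside ∷ B} B⊆A = out⊆ (insertAt-⊆ j b (drop-∷-⊆ B⊆A))
insertAt-⊆ (suc j) b {inside ∷ A}  {inside ∷ B}  B⊆A = s⊆s (insertAt-⊆ j b (drop-∷-⊆ B⊆A))
insertAt-⊆ (suc j) b {outside ∷ A} {inside ∷ B}  B⊆A = contradiction (B⊆A here) λ ()

insertAt-⊆⁻ : ∀ (j : Fin (suc m)) b {A B : Subset m} → insertAt B j b ⊆ insertAt A j b → B ⊆ A
insertAt-⊆⁻ zero    b B⊆A = drop-∷-⊆ B⊆A
insertAt-⊆⁻ (suc j) b {_ ∷ A}       {outside ∷ B} B⊆A = out⊆ (insertAt-⊆⁻ j b (drop-∷-⊆ B⊆A))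
insertAt-⊆⁻ (suc j) b {inside ∷ A}  {inside ∷ B}  B⊆A = s⊆s (insertAt-⊆⁻ j b (drop-∷-⊆ B⊆A))
insertAt-⊆⁻ (suc j) b {outside ∷ A} {inside ∷ B}  B⊆A = contradiction (B⊆A here) λ ()

insertAt-∩ : ∀ (j : Fin (suc m)) b c (A B : Subset m) →
             insertAt A j b ∩ insertAt B j c ≡ insertAt (A ∩ B) j (b ∧ c)
insertAt-∩ zero    b c A       B       = refl
insertAt-∩ (suc j) b c (a ∷ A) (a′ ∷ B) = cong (a ∧ a′ ∷_) (insertAt-∩ j b c A B)

nonempty-insertAt-outside⁻ : ∀ (j : Fin (suc m)) (A : Subset m) →
                             Nonempty (insertAt A j outside) → Nonempty A
nonempty-insertAt-outside⁻ zero    A            (suc x , there x∈) = x , x∈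
nonempty-insertAt-outside⁻ (suc j) (inside ∷ A) (zero , here)      = zero , here
nonempty-insertAt-outside⁻ (suc j) (_ ∷ A)      (suc x , there x∈) =
  let y , y∈A = nonempty-insertAt-outside⁻ j A (x , x∈) in suc y , there y∈A

does-punchIn-∈?-insertAt : ∀ (j : Fin (suc m)) i (A : Subset m) b →
                           does (punchIn j i ∈? insertAt A j b) ≡ does (i ∈? A)
does-punchIn-∈?-insertAt zero    i       A             b = refl
does-punchIn-∈?-insertAt (suc j) zero    (inside  ∷ A) b = refl
does-punchIn-∈?-insertAt (suc j) zero    (outside ∷ A) b = refl
does-punchIn-∈?-insertAt (suc j) (suc i) (_ ∷ A)       b = does-punchIn-∈?-insertAt j i A b

∈-insertAt-inside : ∀ (j : Fin (suc m)) (A : Subset m) → j ∈ insertAt A j inside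
∈-insertAt-inside j A = lookup⇒[]= j _ (insertAt-lookup A j inside)

∣insertAt-outside∣ : ∀ (j : Fin (suc m)) (A : Subset m) → ∣ insertAt A j outside ∣ ≡ ∣ A ∣
∣insertAt-outside∣ zero    A             = refl
∣insertAt-outside∣ (suc j) (inside  ∷ A) = cong suc (∣insertAt-outside∣ j A)
∣insertAt-outside∣ (suc j) (outside ∷ A) = ∣insertAt-outside∣ j A

insertAt-removeAt-∉ : ∀ {j : Fin (suc m)} {W} → j ∉ W → insertAt (removeAt W j) j outside ≡ W
insertAt-removeAt-∉ {j = j} {W} j∉W with lookup W j in W[j]
... | inside  = contradiction (lookup⇒[]= j W W[j]) j∉W
... | outside = subst (λ b → insertAt (removeAt W j) j b ≡ W) W[j] (insertAt-removeAt W j)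

∃∉ : (W : Subset m) → ∣ W ∣ < m → ∃[ j ] j ∉ W
∃∉ {m} W ∣W∣<m = ¬∀⟶∃¬ m (_∈ W) (_∈? W) λ all∈ →
  <⇒≱ ∣W∣<m (subst (_≤ ∣ W ∣) (∣⊤∣≡n m) (p⊆q⇒∣p∣≤∣q∣ {p = ⊤} (λ {x} _ → all∈ x)))

delete : Fin (suc m) → Family (suc m) → Family m
delete j F A = F (insertAt A j outside)

module _ (j : Fin (suc m)) {D : Family (suc m)}
         (avoids : ∀ A → D (insertAt A j inside) ≡ false) where

  ∣delete∣ : ∣ delete j D ∣F ≡ ∣ D ∣F
  ∣delete∣ = sym (trans (ΣS-insertAt j (toℕ ∘ D))
                        (cong (_+ ∣ delete j D ∣F) (ΣS-zero (λ A → cong toℕ (avoids A)))))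

  deg-delete : ∀ i → deg i (delete j D) ≡ deg (punchIn j i) D
  deg-delete i = sym (trans (ΣS-insertAt j _) (cong₂ _+_ (ΣS-zero vanishes) (ΣS-cong relabel)))
    where
    vanishes : ∀ A → (if does (punchIn j i ∈? insertAt A j inside)
                      then toℕ (D (insertAt A j inside)) else 0) ≡ 0
    vanishes A rewrite avoids A = if-then-0-else-0 _
    relabel : ∀ A → (if does (punchIn j i ∈? insertAt A j outside)
                     then toℕ (D (insertAt A j outside)) else 0)
                  ≡ (if does (i ∈? A) then toℕ (D (insertAt A j outside)) else 0)
    relabel A rewrite does-punchIn-∈?-insertAt j i A outside = refl

delete-obstruction : ∀ (j : Fin (suc m)) {D G} → (∀ A → D (insertAt A j inside) ≡ false) →
                     Obstruction D G → Obstruction (delete j D) (delete j G)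
delete-obstruction j {D} {G} avoids ob = record
  { downset      = λ A B B⊆A → downset _ _ (insertAt-⊆ j outside B⊆A)
  ; G⊆D          = λ A → G⊆D _
  ; intersecting = λ A B A∈ B∈ → nonempty-insertAt-outside⁻ j (A ∩ B)
                     (subst Nonempty (insertAt-∩ j outside outside A B) (intersecting _ _ A∈ B∈))
  ; nonempty     = subst (1 ≤_) (sym ∣delete-G∣) nonempty
  ; beatsStars   = λ i → subst₂ _<_ (sym (deg-delete j avoids i)) (sym ∣delete-G∣)
                                     (beatsStars (punchIn j i))
  }
  where
  open Obstruction ob
  ∣delete-G∣ : ∣ delete j G ∣F ≡ ∣ G ∣F
  ∣delete-G∣ = ∣delete∣ j (λ A → ⊆F-false G⊆D _ (avoids A))

livesOn-avoids : ∀ {D : Family (suc m)} {W j} → LivesOn D W → j ∉ W →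
                 ∀ A → D (insertAt A j inside) ≡ false
livesOn-avoids {j = j} D⊆W j∉W A = ¬-not λ A∈D → j∉W (D⊆W _ A∈D (∈-insertAt-inside j A))

delete-livesOn : ∀ {D : Family (suc m)} {W j} → LivesOn D W → j ∉ W →
                 LivesOn (delete j D) (removeAt W j)
delete-livesOn {W = W} {j} D⊆W j∉W A A∈ =
  insertAt-⊆⁻ j outside
    (subst (insertAt A j outside ⊆_) (sym (insertAt-removeAt-∉ j∉W)) (D⊆W _ A∈))

∣removeAt-∉∣ : ∀ {W : Subset (suc m)} {j} → j ∉ W → ∣ removeAt W j ∣ ≡ ∣ W ∣
∣removeAt-∉∣ {W = W} {j} j∉W =
  trans (sym (∣insertAt-outside∣ j (removeAt W j))) (cong ∣_∣ (insertAt-removeAt-∉ j∉W))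

-- Delete points outside W while the ground set is larger than n, then pad with unused points.
reground-obstruction : ∀ n {D G : Family m} (W : Subset m) → LivesOn D W → ∣ W ∣ ≤ n →
                       Obstruction D G → ∃Obstruction n
reground-obstruction {m} n W D⊆W ∣W∣≤n ob with m ≤? n
... | yes m≤n with k , m+k≡n ← m≤n⇒∃[o]m+o≡n m≤n =
  subst ∃Obstruction (trans (+-comm k m) m+k≡n) (pad-∃Obstruction k (_ , _ , ob))
reground-obstruction {zero}  n W D⊆W ∣W∣≤n ob | no m≰n = contradiction z≤n m≰n
reground-obstruction {suc m} n W D⊆W ∣W∣≤n ob | no m≰n
  with j , j∉W ← ∃∉ W (≤-<-trans ∣W∣≤n (≰⇒> m≰n)) =
  reground-obstruction n (removeAt W j) (delete-livesOn D⊆W j∉W)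
    (subst (_≤ n) (sym (∣removeAt-∉∣ j∉W)) ∣W∣≤n)
    (delete-obstruction j (livesOn-avoids D⊆W j∉W) ob)

NoObstruction : ℕ → Set
NoObstruction n = ¬ ∃Obstruction n

noObstruction⇒degreeBounded : NoObstruction n → {D : Family m} → IsDownset D → ∣ U D ∣ ≤ n →
                              DegreeBounded D
noObstruction⇒degreeBounded {n} {m} none {D} downset ∣U∣≤n G G⊆D intersecting
  with 1 ≤? ∣ G ∣F
... | no ∣G∣≱1 = inj₁ (n≤0⇒n≡0 (≮⇒≥ ∣G∣≱1))
... | yes ∣G∣≥1 =
  inj₂ (map₂ ≮⇒≥ (¬∀⟶∃¬ m _ (λ i → deg i D <? ∣ G ∣F) beatsStars⇒⊥))
  where
  beatsStars⇒⊥ : ¬ (∀ i → deg i D < ∣ G ∣F)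
  beatsStars⇒⊥ beats = none (reground-obstruction n (U D) (livesOn-U D) ∣U∣≤n record
    { downset = downset ; G⊆D = G⊆D ; intersecting = intersecting
    ; nonempty = ∣G∣≥1 ; beatsStars = beats })

noObstruction⇒allDownsetsStar : NoObstruction n → AllDownsetsStar n
noObstruction⇒allDownsetsStar none m D downset ∣U∣≤n =
  degreeBounded⇒starProperty (noObstruction⇒degreeBounded none downset ∣U∣≤n)

-- The integer programs

IntersectingConstraint : (Subset m → ℕ) → Set
IntersectingConstraint {m} y =
  ∀ (S T : Subset m) → Nonempty S → Nonempty T → Empty (S ∩ T) → y T + y S ≤ 1

ΣS≠∅-vanishing : {f : Subset m → ℕ} → (∀ A → ¬ Nonempty A → f A ≡ 0) → ΣS≠∅ f ≡ ΣS f
ΣS≠∅-vanishing {f = f} vanishes = ΣS-cong restrict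
  where
  restrict : ∀ A → (if does (nonempty? A) then f A else 0) ≡ f A
  restrict A with nonempty? A
  ... | yes _     = refl
  ... | no  A≡∅ = sym (vanishes A A≡∅)

intersecting-∌∅ : ∀ {G : Family m} → Intersecting G → ∀ A → ¬ Nonempty A → G A ≡ false
intersecting-∌∅ intersecting A A≡∅ = ¬-not λ A∈G →
  let x , x∈A∩A = intersecting A A A∈G A∈G in A≡∅ (x , proj₁ (x∈p∩q⁻ A A x∈A∩A))

module _ {D G : Family n} (ob : Obstruction D G) where
  open Obstruction ob

  ΣS≠∅-indicator : ΣS≠∅ (toℕ ∘ G) ≡ ∣ G ∣F
  ΣS≠∅-indicator = ΣS≠∅-vanishing (λ A A≡∅ → cong toℕ (intersecting-∌∅ intersecting A A≡∅))

  indicator-kleitman : ΣS≠∅ (λ S → 2 * toℕ (G S)) ≤ ΣS (toℕ ∘ D)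
  indicator-kleitman = begin
    ΣS≠∅ (λ S → 2 * toℕ (G S)) ≡⟨ ΣS≠∅-vanishing (λ A A≡∅ →
                                    cong ((2 *_) ∘ toℕ) (intersecting-∌∅ intersecting A A≡∅)) ⟩
    ΣS (λ S → 2 * toℕ (G S))   ≡⟨ ΣS-*ˡ 2 (toℕ ∘ G) ⟩
    2 * ∣ G ∣F                 ≤⟨ kleitman downset G⊆D intersecting ⟩
    ∣ D ∣F                     ∎
    where open ≤-Reasoning

  indicator-intersecting : IntersectingConstraint (toℕ ∘ G)
  indicator-intersecting S T _ _ S∩T≡∅ =
    toℕ+toℕ≤1 (G T) (G S) (λ (T∈G , S∈G) → S∩T≡∅ (intersecting S T S∈G T∈G))

  obstruction⇒I′-feasible : I′-Feasible n (toℕ ∘ D) (toℕ ∘ G)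
  obstruction⇒I′-feasible =
    (λ S → toℕ≤1 (D S)) , (λ S → toℕ≤1 (G S)) ,
    (λ S T S⊂T → toℕ-mono (downset T S (proj₁ S⊂T))) ,
    indicator-intersecting ,
    (λ S → toℕ-mono (G⊆D S)) ,
    (λ i → subst₂ _≤_ (+-comm 1 (deg i D)) (sym ΣS≠∅-indicator) (beatsStars i)) ,
    indicator-kleitman

  obstruction⇒O′-feasible : O′-Feasible n (toℕ ∘ D) (toℕ ∘ G) (∣ G ∣F ∸ 1)
  obstruction⇒O′-feasible =
    (λ S → toℕ≤1 (D S)) , (λ S → toℕ≤1 (G S)) ,
    indicator-intersecting ,
    (λ i → <⇒≤pred (beatsStars i)) ,
    (λ S T S⊆T → toℕ-mono (downset T S S⊆T ∘ G⊆D T)) ,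
    indicator-kleitman

I′-infeasible⇒noObstruction : I′-Infeasible n → NoObstruction n
I′-infeasible⇒noObstruction infeasible (_ , _ , ob) =
  infeasible (_ , _ , obstruction⇒I′-feasible ob)

-- An obstruction has objective value |G| - (|G| - 1) = 1 in O′.
O′-optimal-0⇒noObstruction : O′-OptimalValue n (+ 0) → NoObstruction n
O′-optimal-0⇒noObstruction (_ , optimal) (_ , G , ob) =
  <⇒≱ (∸-monoʳ-< {o = 0} (s≤s z≤n) (Obstruction.nonempty ob))
      (subst (_≤ ∣ G ∣F ∸ 1) (ΣS≠∅-indicator ob) objective≤0)
  where
  objective≤0 : ΣS≠∅ (toℕ ∘ G) ≤ ∣ G ∣F ∸ 1
  objective≤0 = drop‿+≤+ (i-j≤0⇒i≤j (optimal _ _ _ (obstruction⇒O′-feasible ob)))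

⊆⇒≡⊎⊂ : {A B : Subset m} → B ⊆ A → B ≡ A ⊎ B ⊂ A
⊆⇒≡⊎⊂ {A = []}    {[]}    _   = inj₁ refl
⊆⇒≡⊎⊂ {A = a ∷ A} {b ∷ B} B⊆A with ⊆⇒≡⊎⊂ (drop-∷-⊆ B⊆A)
⊆⇒≡⊎⊂ {A = inside  ∷ A} {inside  ∷ B} B⊆A | inj₁ refl = inj₁ refl
⊆⇒≡⊎⊂ {A = outside ∷ A} {outside ∷ B} B⊆A | inj₁ refl = inj₁ refl
⊆⇒≡⊎⊂ {A = inside  ∷ A} {outside ∷ B} B⊆A | inj₁ refl = inj₂ (B⊆A , zero , here , λ ())
⊆⇒≡⊎⊂ {A = outside ∷ A} {inside  ∷ B} B⊆A | inj₁ refl = contradiction (B⊆A here) λ ()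
⊆⇒≡⊎⊂ {A = a ∷ A} {b ∷ B} B⊆A | inj₂ (_ , x , x∈A , x∉B) =
  inj₂ (B⊆A , suc x , there x∈A , λ { (there x∈B) → x∉B x∈B })

antitone-⊆ : {x : Subset m → ℕ} → (∀ S T → S ⊂ T → x T ≤ x S) → ∀ {S T} → S ⊆ T → x T ≤ x S
antitone-⊆ antitone {S} {T} S⊆T with ⊆⇒≡⊎⊂ S⊆T
... | inj₁ refl = ≤-refl
... | inj₂ S⊂T  = antitone S T S⊂T

if-mono : ∀ c {a b} → a ≤ b → (if c then a else 0) ≤ (if c then b else 0)
if-mono true  a≤b = a≤b
if-mono false _   = z≤n

module _ {y : Subset m → ℕ} where

  ∈-support∩nonempty⁻ : ∀ {A} → A ∈F (support y ∩F nonemptySets) → 1 ≤ y A × Nonempty A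
  ∈-support∩nonempty⁻ {A} A∈ =
    ∈-familyOf⁻ (λ A → 1 ≤? y A) (∧-conicalˡ (support y A) _ A∈) ,
    ∈-familyOf⁻ nonempty? (∧-conicalʳ (support y A) _ A∈)

  support∩nonempty-intersecting : IntersectingConstraint y →
                                  Intersecting (support y ∩F nonemptySets)
  support∩nonempty-intersecting constraint A B A∈ B∈ with nonempty? (A ∩ B)
  ... | yes A∩B≢∅ = A∩B≢∅
  ... | no  A∩B≡∅ =
    let 1≤yA , A≢∅ = ∈-support∩nonempty⁻ A∈
        1≤yB , B≢∅ = ∈-support∩nonempty⁻ B∈
    in contradiction (≤-trans (+-mono-≤ 1≤yB 1≤yA) (constraint A B A≢∅ B≢∅ A∩B≡∅)) λ { (s≤s ()) }

  downClosure-≤ : {x : Subset m → ℕ} → (∀ S T → S ⊆ T → y T ≤ x S) →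
                  ∀ A → toℕ (downClosure (support y ∩F nonemptySets) A) ≤ x A
  downClosure-≤ {x} y≤x A with downClosure (support y ∩F nonemptySets) A in A∈
  ... | false = z≤n
  ... | true  =
    let T , T∈ , A⊆T = ∈-familyOf⁻ (hasSupersetIn? (support y ∩F nonemptySets)) A∈
    in ≤-trans (proj₁ (∈-support∩nonempty⁻ T∈)) (y≤x A T A⊆T)

downClosure-downset : (G : Family m) → IsDownset (downClosure G)
downClosure-downset G A B B⊆A A∈ =
  let T , T∈G , A⊆T = ∈-familyOf⁻ (hasSupersetIn? G) A∈
  in ∈-familyOf⁺ (hasSupersetIn? G) (T , T∈G , A⊆T ∘ B⊆A)

⊆F-downClosure : (G : Family m) → G ⊆F downClosure G
⊆F-downClosure G A A∈G = ∈-familyOf⁺ (hasSupersetIn? G) (A , A∈G , ⊆-refl)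

-- Apply the star property to the downset generated by the intersecting family {y = 1}.
allDownsetsStar⇒ΣS≠∅-≤-degree :
  AllDownsetsStar n → ∀ {x y : Subset n → ℕ} → Binary y → IntersectingConstraint y →
  (∀ S T → S ⊆ T → y T ≤ x S) → ΣS≠∅ y ≡ 0 ⊎ ∃[ i ] ΣS≠∅ y ≤ ΣS∋ i x
allDownsetsStar⇒ΣS≠∅-≤-degree {n} all-star {x} {y} y-binary disjoint y≤x =
  Sum.map (trans (sym ∣Y∣≡ΣS≠∅y))
          (λ (i , ∣Y∣≤deg) → i , subst (_≤ ΣS∋ i x) ∣Y∣≡ΣS≠∅y (≤-trans ∣Y∣≤deg (deg≤ΣS∋ i)))
    (starProperty⇒degreeBounded (all-star n D (downClosure-downset Y) (∣p∣≤n (U D)))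
       Y (⊆F-downClosure Y) (support∩nonempty-intersecting {y = y} disjoint))
  where
  Y D : Family n
  Y = support y ∩F nonemptySets
  D = downClosure Y
  ∣Y∣≡ΣS≠∅y : ∣ Y ∣F ≡ ΣS≠∅ y
  ∣Y∣≡ΣS≠∅y = ∣support∩nonempty∣ y-binary
  deg≤ΣS∋ : ∀ i → deg i D ≤ ΣS∋ i x
  deg≤ΣS∋ i = ΣS-mono (λ A → if-mono (does (i ∈? A)) (downClosure-≤ y≤x A))

allDownsetsStar⇒I′-infeasible : 1 ≤ n → AllDownsetsStar n → I′-Infeasible n
allDownsetsStar⇒I′-infeasible {suc _} _ all-star
  (x , y , _ , y-binary , antitone , disjoint , y≤x , beats , _) =
  Sum.[ (λ ΣS≠∅y≡0 → beaten zero (subst (_≤ _) (sym ΣS≠∅y≡0) z≤n)) , uncurry beaten ]′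
    (allDownsetsStar⇒ΣS≠∅-≤-degree all-star y-binary disjoint
       (λ S T S⊆T → ≤-trans (y≤x T) (antitone-⊆ antitone S⊆T)))
  where
  beaten : ∀ i → ¬ ΣS≠∅ y ≤ ΣS∋ i x
  beaten i = <⇒≱ (subst (_≤ ΣS≠∅ y) (+-comm _ 1) (beats i))

allDownsetsStar⇒O′-optimal-0 : AllDownsetsStar n → O′-OptimalValue n (+ 0)
allDownsetsStar⇒O′-optimal-0 {n} all-star =
  ((λ _ → 0) , (λ _ → 0) , 0 , zero-feasible , cong (λ s → + s ℤ.- + 0) ΣS≠∅-zero) ,
  λ x y z → i≤j⇒i-j≤0 ∘ ℤ.+≤+ ∘ objective≤0 x y z
  where
  ΣS≠∅-zero : ΣS≠∅ {n} (λ _ → 0) ≡ 0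
  ΣS≠∅-zero = ΣS-zero {n} (λ A → if-then-0-else-0 (does (nonempty? A)))
  zero-feasible : O′-Feasible n (λ _ → 0) (λ _ → 0) 0
  zero-feasible = (λ _ → z≤n) , (λ _ → z≤n) , (λ _ _ _ _ _ → z≤n) ,
                  (λ i → ≤-reflexive (ΣS-zero (λ A → if-then-0-else-0 (does (i ∈? A))))) ,
                  (λ _ _ _ → z≤n) , ≤-trans (≤-reflexive ΣS≠∅-zero) z≤n
  objective≤0 : ∀ x y z → O′-Feasible n x y z → ΣS≠∅ y ≤ z
  objective≤0 x y z (_ , y-binary , disjoint , degree≤z , y≤x , _)
    with allDownsetsStar⇒ΣS≠∅-≤-degree all-star y-binary disjoint y≤x
  ... | inj₁ ΣS≠∅y≡0      = ≤-trans (≤-reflexive ΣS≠∅y≡0) z≤n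
  ... | inj₂ (i , ΣS≠∅y≤) = ≤-trans ΣS≠∅y≤ (degree≤z i)

corollary2p8 : (n : ℕ) → 1 ≤ n →
    (AllDownsetsStar n ⇔ I′-Infeasible n) × (AllDownsetsStar n ⇔ O′-OptimalValue n (+ 0))
corollary2p8 n 1≤n =
  mk⇔ (allDownsetsStar⇒I′-infeasible 1≤n)
      (noObstruction⇒allDownsetsStar ∘ I′-infeasible⇒noObstruction) ,
  mk⇔ allDownsetsStar⇒O′-optimal-0
      (noObstruction⇒allDownsetsStar ∘ O′-optimal-0⇒noObstruction)
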